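{- Let $\mathcal{A} \subseteq 2^\omega$ be a $\Sigma^0_1$ class. Then the sentence "$\mathcal{A}$ is a largeness class" is $\Pi^0_2$.
   Context: Subsets of $\omega$ are identified with elements of $2^\omega$; a $\Sigma^0_1$ class is an effectively open subset of $2^\omega$. A largeness class is a non-empty collection $\mathcal{A} \subseteq 2^\omega$ such that (a) if $X \in \mathcal{A}$ and $Y \supseteq X$ then $Y \in \mathcal{A}$, and (b) for every $k$ and every sets $Y_0, \dots, Y_{k-1}$ with $Y_0 \cup \dots \cup Y_{k-1} \supseteq \omega$, there is some $j < k$ with $Y_j \in \mathcal{A}$. -}

module Defs where

open import Data.Nat using (ℕ)
open import Data.Bool using (Bool; true)
open import Data.Fin using (Fin)
open import Data.List using (List; applyUpTo)
open import Data.Product using (Σ; ∃)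
open import Relation.Binary.PropositionalEquality using (_≡_)

Cantor : Set
Cantor = ℕ → Bool

_↾_ : Cantor → ℕ → List Bool
X ↾ n = applyUpTo X n

Class : Set₁
Class = Cantor → Set

-- A code for a Σ⁰₁ class: a (computable, as every Agda function is)
-- predicate φ on finite binary strings; the class it names is
-- { X | ∃ n, φ (X ↾ n) = true }.  Every effectively open class is of this form.
Σ01Code : Set
Σ01Code = List Bool → Bool

⟦_⟧ : Σ01Code → Class
⟦ φ ⟧ X = ∃ λ n → φ (X ↾ n) ≡ true

_⊆_ : Cantor → Cantor → Set
X ⊆ Y = ∀ n → X n ≡ true → Y n ≡ true

record IsLargeness (𝒜 : Class) : Set where
  field
    nonempty : ∃ λ X → 𝒜 X
    upward   : ∀ X Y → 𝒜 X → X ⊆ Y → 𝒜 Y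
    partition : ∀ k (Y : Fin k → Cantor) →
                (∀ n → ∃ λ j → Y j n ≡ true) →
                ∃ λ j → 𝒜 (Y j)

-- Because 𝒜 = ⟦ φ ⟧ is open, each clause of largeness becomes the statement
-- that every infinite path through a finitely branching tree has a prefix in a
-- decidable set B of nodes.  For upward closure, fix the length L of the
-- witness φ (X ↾ L) and read a pair X ⊆ Y as a path over the bit pairs x ≤ y;
-- for the partition property, fix the number k of pieces and read a covering
-- as a colouring ω → Fin k.  By König's lemma (where excluded middle enters)
-- such a statement holds iff for some m every string of length m has a prefix
-- in B, a Σ⁰₁ condition; interleaving these countably many Σ⁰₁ conditions
-- gives a Π⁰₂ sentence.
module Submission where

open import Defs
open import Data.Nat using (ℕ)
open import Data.Bool using (Bool; true)
open import Data.Product using (Σ; ∃)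
open import Function.Bundles using (_⇔_)
open import Relation.Binary.PropositionalEquality using (_≡_)
open import Axiom.ExcludedMiddle using (ExcludedMiddle)
open import Level using (0ℓ)

open import Data.Nat using (zero; suc; _≤_; _⊔_; s≤s; _≡ᵇ_)
open import Data.Nat.Properties using (≤-trans; ≤-reflexive; m≤m⊔n; m≤n⊔m; ≡ᵇ⇒≡; ≡⇒≡ᵇ)
open import Data.Bool as Bool using (false; _∨_; _∧_; not; b≤b; f≤t)
open import Data.Bool.Properties using (∨-zeroʳ; ∨-conicalˡ; ¬-not; T-≡)
open import Data.Empty using (⊥; ⊥-elim)
open import Data.Fin as Fin using (Fin)
open import Data.Fin.Properties using () renaming (_≟_ to _≟ᶠ_)
open import Data.List using (List; []; _∷_; map; length; applyUpTo; allFin)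
open import Data.Bool.ListAction using (all; any)
open import Data.List.Properties using (length-applyUpTo; map-applyUpTo)
open import Data.List.Membership.Propositional using (_∈_; lose)
open import Data.List.Membership.Propositional.Properties using (∈-allFin)
open import Data.List.Relation.Unary.All as All using ()
open import Data.List.Relation.Unary.All.Properties using (all⁺; all⁻)
open import Data.List.Relation.Unary.Any using (here; there; satisfied)
open import Data.List.Relation.Unary.Any.Properties using (any⁺; any⁻)
open import Data.Product using (_,_; proj₁; proj₂; _×_)
open import Data.Product.Function.NonDependent.Propositional using (_×-⇔_)
open import Data.Sum using (_⊎_; inj₁; inj₂; [_,_])
open import Function using (_∘_; id)
open import Function.Bundles using (mk⇔; Equivalence)
open import Function.Construct.Composition using (_⇔-∘_)
open import Relation.Nullary using (¬_; yes; no; does)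
open import Relation.Nullary.Decidable using (dec-true)
open import Relation.Binary.PropositionalEquality using (refl; sym; trans; cong; subst)

open Equivalence using (to; from)

Π-⇔ : {A : Set} {P Q : A → Set} → (∀ x → P x ⇔ Q x) → (∀ x → P x) ⇔ (∀ x → Q x)
Π-⇔ P⇔Q = mk⇔ (λ p x → to (P⇔Q x) (p x)) (λ q x → from (P⇔Q x) (q x))

∨-introˡ : ∀ {x} y → x ≡ true → x ∨ y ≡ true
∨-introˡ _ refl = refl

∨-introʳ : ∀ x {y} → y ≡ true → x ∨ y ≡ true
∨-introʳ x refl = ∨-zeroʳ x

true≢false : ∀ {x} → x ≡ true → x ≡ false → ⊥
true≢false refl ()

any-true : ∀ {A : Set} {p : A → Bool} {x xs} → x ∈ xs → p x ≡ true → any p xs ≡ true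
any-true x∈xs px = to T-≡ (any⁺ _ (lose x∈xs (from T-≡ px)))

any-witness : ∀ {A : Set} {p : A → Bool} xs → any p xs ≡ true → ∃ λ x → p x ≡ true
any-witness xs pxs = let x , px = satisfied (any⁻ _ xs (from T-≡ pxs)) in x , to T-≡ px

common-bound : {A : Set} (P : A → ℕ → Set) → (∀ {a m n} → m ≤ n → P a m → P a n) →
               (∀ a → ∃ (P a)) → ∀ xs → ∃ λ M → ∀ {a} → a ∈ xs → P a M
common-bound P mono bound [] = 0 , λ ()
common-bound P mono bound (a ∷ xs) =
  let m , pm = bound a ; M , pM = common-bound P mono bound xs in
  m ⊔ M , λ { (here refl) → mono (m≤m⊔n m M) pm ; (there a∈xs) → mono (m≤n⊔m m M) (pM a∈xs) }

-- interleave f g = f 0 , g 0 , f 1 , g 1 , …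
interleave : {A : Set} → (ℕ → A) → (ℕ → A) → ℕ → A
interleave f g zero    = f 0
interleave f g (suc n) = interleave g (f ∘ suc) n

×-∀⇔∀-interleave : {A : Set} (P : A → Set) (f g : ℕ → A) →
                   ((∀ n → P (f n)) × (∀ n → P (g n))) ⇔ (∀ n → P (interleave f g n))
×-∀⇔∀-interleave P f g =
  mk⇔ (λ (pf , pg) → merge f g pf pg) (λ h → evens f g h , evens g (f ∘ suc) (h ∘ suc))
  where
  merge : ∀ f g → (∀ n → P (f n)) → (∀ n → P (g n)) → ∀ n → P (interleave f g n)
  merge f g pf pg zero    = pf 0
  merge f g pf pg (suc n) = merge g (f ∘ suc) pg (pf ∘ suc) n

  evens : ∀ f g → (∀ n → P (interleave f g n)) → ∀ n → P (f n)
  evens f g h zero    = h 0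
  evens f g h (suc n) = evens (f ∘ suc) (g ∘ suc) (h ∘ suc ∘ suc) n

anyPrefix : {A : Set} → (List A → Bool) → List A → Bool
anyPrefix B []      = B []
anyPrefix B (a ∷ t) = B [] ∨ anyPrefix (B ∘ (a ∷_)) t

anyPrefix-[] : {A : Set} (B : List A → Bool) (t : List A) → anyPrefix B t ≡ false → B [] ≡ false
anyPrefix-[] B []      e = e
anyPrefix-[] B (a ∷ t) e = ∨-conicalˡ (B []) _ e

anyPrefix-applyUpTo : {A : Set} (B : List A → Bool) (f : ℕ → A) (m : ℕ) →
                      anyPrefix B (applyUpTo f m) ≡ true → ∃ λ n → B (applyUpTo f n) ≡ true
anyPrefix-applyUpTo B f zero    p = 0 , p
anyPrefix-applyUpTo B f (suc m) p with B [] in eq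
... | true  = 0 , eq
... | false = let n , q = anyPrefix-applyUpTo (B ∘ (f 0 ∷_)) (f ∘ suc) m p in suc n , q

allOfLength : {A : Set} → List A → ℕ → (List A → Bool) → Bool
allOfLength as zero    P = P []
allOfLength as (suc m) P = all (λ a → allOfLength as m (P ∘ (a ∷_))) as

Barred : {A : Set} → (List A → Bool) → Set
Barred B = ∀ f → ∃ λ n → B (applyUpTo f n) ≡ true

module FanTheorem {A : Set} (as : List A) (∈-as : ∀ a → a ∈ as) where

  allOfLength-sound : ∀ m P → allOfLength as m P ≡ true → ∀ t → length t ≡ m → P t ≡ true
  allOfLength-sound zero    P p []      refl = p
  allOfLength-sound (suc m) P p (a ∷ t) refl =
    allOfLength-sound m (P ∘ (a ∷_)) (to T-≡ (All.lookup (all⁺ _ as (from T-≡ p)) (∈-as a))) t refl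

  allOfLength-complete : ∀ m P → (∀ t → length t ≡ m → P t ≡ true) → allOfLength as m P ≡ true
  allOfLength-complete zero    P h = h [] refl
  allOfLength-complete (suc m) P h = to T-≡ (all⁻ _ (All.universal children as))
    where
    children : ∀ a → Bool.T (allOfLength as m (P ∘ (a ∷_)))
    children a = from T-≡ (allOfLength-complete m (P ∘ (a ∷_)) (λ t e → h (a ∷ t) (cong suc e)))

  UniformlyBarred : (List A → Bool) → ℕ → Set
  UniformlyBarred B m = ∀ t → m ≤ length t → anyPrefix B t ≡ true

  HasLongAvoiders : (List A → Bool) → Set
  HasLongAvoiders B = ∀ m → ∃ λ t → m ≤ length t × anyPrefix B t ≡ false

  uniformlyBarred⇒¬longAvoiders : ∀ {B m} → UniformlyBarred B m → ¬ HasLongAvoiders B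
  uniformlyBarred⇒¬longAvoiders {m = m} bar long =
    let t , m≤t , e = long m in true≢false (bar t m≤t) e

  uniformlyBarred-mono : ∀ {B m n} → m ≤ n → UniformlyBarred B m → UniformlyBarred B n
  uniformlyBarred-mono m≤n bar t n≤t = bar t (≤-trans m≤n n≤t)

  uniformlyBarred-children : ∀ B → (∀ a → ∃ (UniformlyBarred (B ∘ (a ∷_)))) → ∃ (UniformlyBarred B)
  uniformlyBarred-children B bars =
    let M , barM = common-bound (λ a → UniformlyBarred (B ∘ (a ∷_))) uniformlyBarred-mono bars as in
    suc M , λ { [] () ; (a ∷ t) (s≤s M≤t) → ∨-introʳ (B []) (barM (∈-as a) t M≤t) }

  module _ (lem : ExcludedMiddle 0ℓ) where

    uniformlyBarred⊎longAvoiders : ∀ B → ∃ (UniformlyBarred B) ⊎ HasLongAvoiders B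
    uniformlyBarred⊎longAvoiders B with lem {∃ (UniformlyBarred B)}
    ... | yes bar = inj₁ bar
    ... | no ¬bar = inj₂ long
      where
      long : HasLongAvoiders B
      long m with lem {∃ λ t → m ≤ length t × anyPrefix B t ≡ false}
      ... | yes avoider = avoider
      ... | no ¬avoider = ⊥-elim (¬bar (m , λ t m≤t → ¬-not (λ e → ¬avoider (t , m≤t , e))))

    longAvoiders-child : ∀ B → HasLongAvoiders B → ∃ λ a → HasLongAvoiders (B ∘ (a ∷_))
    longAvoiders-child B long with lem {∃ λ a → HasLongAvoiders (B ∘ (a ∷_))}
    ... | yes child = child
    ... | no ¬child =
      ⊥-elim (uniformlyBarred⇒¬longAvoiders (proj₂ (uniformlyBarred-children B childBar)) long)
      where
      childBar : ∀ a → ∃ (UniformlyBarred (B ∘ (a ∷_)))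
      childBar a = [ id , (λ l → ⊥-elim (¬child (a , l))) ] (uniformlyBarred⊎longAvoiders (B ∘ (a ∷_)))

    avoidingPath : ∀ B → HasLongAvoiders B → ℕ → A
    avoidingPath B long zero    = proj₁ (longAvoiders-child B long)
    avoidingPath B long (suc n) = avoidingPath _ (proj₂ (longAvoiders-child B long)) n

    avoidingPath-avoids : ∀ B (long : HasLongAvoiders B) (n : ℕ) →
                          B (applyUpTo (avoidingPath B long) n) ≡ false
    avoidingPath-avoids B long zero    = let t , _ , e = long 0 in anyPrefix-[] B t e
    avoidingPath-avoids B long (suc n) = avoidingPath-avoids _ (proj₂ (longAvoiders-child B long)) n

    barred⇒uniformlyBarred : ∀ B → Barred B → ∃ (UniformlyBarred B)
    barred⇒uniformlyBarred B barred =
      [ id , (λ long → ⊥-elim (pathBarred long)) ] (uniformlyBarred⊎longAvoiders B)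
      where
      pathBarred : ¬ HasLongAvoiders B
      pathBarred long =
        let n , e = barred (avoidingPath B long) in true≢false e (avoidingPath-avoids B long n)

    barred⇔allOfLength : ∀ B → Barred B ⇔ (∃ λ m → allOfLength as m (anyPrefix B) ≡ true)
    barred⇔allOfLength B = mk⇔
      (λ barred → let m , bar = barred⇒uniformlyBarred B barred in
                  m , allOfLength-complete m (anyPrefix B) (λ t e → bar t (≤-reflexive (sym e))))
      (λ (m , check) f →
         anyPrefix-applyUpTo B f m
           (allOfLength-sound m (anyPrefix B) check (applyUpTo f m) (length-applyUpTo f m)))

record Pair≤ : Set where
  constructor pair
  field
    lower upper : Bool
    lower≤upper : lower Bool.≤ upper
open Pair≤

pairs≤ : List Pair≤
pairs≤ = pair false false b≤b ∷ pair false true f≤t ∷ pair true true b≤b ∷ []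

∈-pairs≤ : ∀ p → p ∈ pairs≤
∈-pairs≤ (pair false false b≤b) = here refl
∈-pairs≤ (pair false true  f≤t) = there (here refl)
∈-pairs≤ (pair true  true  b≤b) = there (there (here refl))

⇒-≤ : ∀ {x y} → (x ≡ true → y ≡ true) → x Bool.≤ y
⇒-≤ {false} {false} _ = b≤b
⇒-≤ {false} {true}  _ = f≤t
⇒-≤ {true}  {true}  _ = b≤b
⇒-≤ {true}  {false} h = ⊥-elim (true≢false (h refl) refl)

≤-⇒ : ∀ {x y} → x Bool.≤ y → x ≡ true → y ≡ true
≤-⇒ b≤b p = p

colourClass : ∀ {k} → (ℕ → Fin k) → Fin k → Cantor
colourClass f j i = does (f i ≟ᶠ j)

UpwardClosed : Class → Set
UpwardClosed 𝒜 = ∀ X Y → 𝒜 X → X ⊆ Y → 𝒜 Y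

PartitionRegular : Class → Set
PartitionRegular 𝒜 = ∀ k (Y : Fin k → Cantor) → (∀ n → ∃ λ j → Y j n ≡ true) → ∃ λ j → 𝒜 (Y j)

module _ (φ : Σ01Code) where

  upwardCode : ℕ → List Pair≤ → Bool
  upwardCode L s = φ (map upper s) ∨ ((length s ≡ᵇ L) ∧ not (φ (map lower s)))

  partitionCode : ∀ k → List (Fin k) → Bool
  partitionCode k s = any (λ j → φ (map (λ c → does (c ≟ᶠ j)) s)) (allFin k)

  upwardCode-elim : ∀ L s → upwardCode L s ≡ true →
                    φ (map upper s) ≡ true ⊎ (length s ≡ L × φ (map lower s) ≡ false)
  upwardCode-elim L s p with φ (map upper s) | length s ≡ᵇ L in eq | φ (map lower s)
  upwardCode-elim L s p  | true  | _     | _     = inj₁ refl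
  upwardCode-elim L s p  | false | true  | false = inj₂ (≡ᵇ⇒≡ _ _ (from T-≡ eq) , refl)
  upwardCode-elim L s () | false | true  | true
  upwardCode-elim L s () | false | false | _

  upwardCode-unwitnessed : ∀ L s → length s ≡ L → φ (map lower s) ≡ false → upwardCode L s ≡ true
  upwardCode-unwitnessed L s eq e rewrite to T-≡ (≡⇒≡ᵇ _ _ eq) | e = ∨-zeroʳ _

  upward⇒barred : UpwardClosed ⟦ φ ⟧ → ∀ L → Barred (upwardCode L)
  upward⇒barred up L f with φ (applyUpTo (lower ∘ f) L) in eq
  ... | true  = let n , e = up (lower ∘ f) (upper ∘ f) (L , eq) (λ i → ≤-⇒ (lower≤upper (f i))) in
                n , ∨-introˡ _ (trans (cong φ (map-applyUpTo f upper n)) e)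
  ... | false = L , upwardCode-unwitnessed L _ (length-applyUpTo f L)
                      (trans (cong φ (map-applyUpTo f lower L)) eq)

  barred⇒upward : (∀ L → Barred (upwardCode L)) → UpwardClosed ⟦ φ ⟧
  barred⇒upward barred X Y (L , X∈) X⊆Y with barred L (λ i → pair (X i) (Y i) (⇒-≤ (X⊆Y i)))
  ... | n , p with upwardCode-elim L _ p
  ...   | inj₁ Y∈ = n , trans (cong φ (sym (map-applyUpTo _ upper n))) Y∈
  ...   | inj₂ (n≡L , X∉) = ⊥-elim (true≢false X∈ (subst (λ m → φ (X ↾ m) ≡ false) lengthL X∉'))
    where
    lengthL : n ≡ L
    lengthL = trans (sym (length-applyUpTo _ n)) n≡L

    X∉' : φ (X ↾ n) ≡ false
    X∉' = trans (cong φ (sym (map-applyUpTo _ lower n))) X∉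

  partition⇒barred : PartitionRegular ⟦ φ ⟧ → ∀ k → Barred (partitionCode k)
  partition⇒barred part k f =
    let j , n , e = part k (colourClass f) (λ i → f i , dec-true (f i ≟ᶠ f i) refl) in
    n , any-true (∈-allFin j) (trans (cong φ (map-applyUpTo f _ n)) e)

  barred⇒partition : UpwardClosed ⟦ φ ⟧ → (∀ k → Barred (partitionCode k)) → PartitionRegular ⟦ φ ⟧
  barred⇒partition up barred k Y cover =
    let n , p = barred k colour ; j , q = any-witness (allFin k) p in
    j , up (colourClass colour j) (Y j)
           (n , trans (cong φ (sym (map-applyUpTo colour _ n))) q) (colourClass⊆ j)
    where
    colour : ℕ → Fin k
    colour i = proj₁ (cover i)

    colourClass⊆ : ∀ j → colourClass colour j ⊆ Y j
    colourClass⊆ j i e  with colour i ≟ᶠ j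
    colourClass⊆ j i e  | yes refl = proj₂ (cover i)
    colourClass⊆ j i () | no _

  largeness⇔barred : IsLargeness ⟦ φ ⟧ ⇔
                     ((∀ L → Barred (upwardCode L)) × (∀ k → Barred (partitionCode k)))
  largeness⇔barred = mk⇔
    (λ large → upward⇒barred (IsLargeness.upward large)
             , partition⇒barred (IsLargeness.partition large))
    (λ (up , part) → let upward = barred⇒upward up ; partition = barred⇒partition upward part in
      record
        { nonempty  = let _ , X∈ = partition 1 (λ _ _ → true) (λ _ → Fin.zero , refl) in _ , X∈
        ; upward    = upward
        ; partition = partition
        })

upwardCheck : Σ01Code → ℕ → ℕ → Bool
upwardCheck φ L m = allOfLength pairs≤ m (anyPrefix (upwardCode φ L))

partitionCheck : Σ01Code → ℕ → ℕ → Bool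
partitionCheck φ k m = allOfLength (allFin k) m (anyPrefix (partitionCode φ k))

R : Σ01Code → ℕ → ℕ → Bool
R φ = interleave (upwardCheck φ) (partitionCheck φ)

lemma2p3 : Σ (Σ01Code → ℕ → ℕ → Bool) λ R →
    ExcludedMiddle 0ℓ →
    ∀ (φ : Σ01Code) →
    IsLargeness ⟦ φ ⟧ ⇔ (∀ n → ∃ λ m → R φ n m ≡ true)
lemma2p3 = R , λ lem φ →
  (×-∀⇔∀-interleave (λ c → ∃ λ m → c m ≡ true) (upwardCheck φ) (partitionCheck φ)
    ⇔-∘ ((Π-⇔ λ L → FanTheorem.barred⇔allOfLength pairs≤ ∈-pairs≤ lem (upwardCode φ L))
          ×-⇔ (Π-⇔ λ k → FanTheorem.barred⇔allOfLength (allFin k) ∈-allFin lem (partitionCode φ k))))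
    ⇔-∘ largeness⇔barred φ
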